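{- Let $\nu=(\nu_1,\dots,\nu_t)\in\mathcal{E}$. Then for every $i\in[1,t-2]$ such that $\nu_{i+1}$ has a secondary color, $\nu_{i+2}$ has a primary color, and $(c(\nu_i),c(\nu_{i+1}))\notin\{(ad,bc),(cd,ab)\}$, we have $\nu_i\succ\nu_{i+2}+2$. Furthermore, the following are equivalent: (1) $\nu\in\mathcal{E}_1$; (2) for every $i\in[1,t-2]$ such that $(\nu_i,\nu_{i+1})$ is of the form $((k+1)_{ad},k_{bc})$ or $(k_{cd},k_{ab})$ for some $k$ and is different from $(3_{ad},2_{bc})$, we have $\nu_i\succeq\nu_{i+2}+2$.
   Context: Colors: primary $a,b,c,d$; secondary $ab,ac,ad,bc,bd,cd$; totally ordered by $ab<ac<ad<a<bc<bd<b<cd<c<d$. A colored part $k_p$ has integer size $k$ and color $c(k_p)=p$; $k_p+m=(k+m)_p$. Write $\chi(S)=1$ if $S$ holds and $0$ otherwise. The strict order $\succ$: $k_p\succ l_q\iff k-l\ge\chi(p\le q)$; $x\succeq y$ means $x\succ y$ or $x=y$. Define $\Delta(p,q)=1+\chi(p<q)$ if at least one of $p,q$ is primary; $\Delta(p,q)=1+\chi(p\le q)$ if both are secondary and $(p,q)\notin\{(cd,ab),(ad,bc)\}$; $\Delta(cd,ab)=0$, $\Delta(ad,bc)=1$. Relation $\gg$: $k_p\gg l_q\iff k-l\ge\Delta(p,q)$. $\mathcal{P}$ is the set of parts with positive size and primary color; $\mathcal{S}$ the set of parts with secondary color and size at least $2$. $\mathcal{E}$ is the set of finite sequences $(\nu_1,\dots,\nu_t)$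 of elements of $\mathcal{P}\sqcup\mathcal{S}$ with $\nu_1\gg\nu_2\gg\cdots\gg\nu_t$. $\mathcal{E}_1\subseteq\mathcal{E}$ is the set of those sequences containing no three consecutive parts equal to $((k+2)_{cd},(k+2)_{ab},k_c)$, $((k+2)_{cd},(k+2)_{ab},k_d)$ or $((k+2)_{ad},(k+1)_{bc},k_a)$ for any $k\ge1$, except that $(3_{ad},2_{bc},1_a)$ is allowed. -}

module Defs where

open import Data.Nat using (ℕ; zero; suc; _+_; _≤_; _≤ᵇ_; _<ᵇ_)
open import Data.Bool using (Bool; true; false; _∧_; _∨_; not; if_then_else_)
open import Data.Product using (_×_; ∃-syntax; _,_)
open import Data.Sum using (_⊎_)
open import Data.List using (List; []; _∷_; _++_)
open import Data.List.Relation.Unary.All using (All)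
open import Data.List.Relation.Unary.Linked using (Linked)
open import Relation.Nullary using (¬_)
open import Relation.Binary.PropositionalEquality using (_≡_)

data Color : Set where
  a b c d ab ac ad bc bd cd : Color

rank : Color → ℕ
rank ab = 0
rank ac = 1
rank ad = 2
rank a  = 3
rank bc = 4
rank bd = 5
rank b  = 6
rank cd = 7
rank c  = 8
rank d  = 9

χ≤ : Color → Color → ℕ
χ≤ p q = if rank p ≤ᵇ rank q then 1 else 0

χ< : Color → Color → ℕ
χ< p q = if rank p <ᵇ rank q then 1 else 0

isPrimaryᵇ : Color → Bool
isPrimaryᵇ a = true
isPrimaryᵇ b = true
isPrimaryᵇ c = true
isPrimaryᵇ d = true
isPrimaryᵇ _ = false

Primary : Color → Set
Primary p = isPrimaryᵇ p ≡ true

Secondary : Color → Set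
Secondary p = isPrimaryᵇ p ≡ false

-- A colored part k_p.  Sizes are natural numbers: every part occurring in
-- the statement (elements of 𝒫 ⊔ 𝒮, and such parts shifted by +2) has
-- positive size.
record Part : Set where
  constructor _⟨_⟩
  field
    size  : ℕ
    color : Color
open Part public

_+ₚ_ : Part → ℕ → Part
(k ⟨ p ⟩) +ₚ m = (k + m) ⟨ p ⟩

-- k_p ≻ l_q  iff  k - l ≥ χ(p ≤ q)   (written as l + χ ≤ k over ℕ)
_≻_ : Part → Part → Set
(k ⟨ p ⟩) ≻ (l ⟨ q ⟩) = l + χ≤ p q ≤ k

_⪰_ : Part → Part → Set
x ⪰ y = x ≻ y ⊎ x ≡ y

Δ : Color → Color → ℕ
Δ cd ab = 0
Δ ad bc = 1
Δ p q = if isPrimaryᵇ p ∨ isPrimaryᵇ q then 1 + χ< p q else 1 + χ≤ p q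

_≫_ : Part → Part → Set
(k ⟨ p ⟩) ≫ (l ⟨ q ⟩) = l + Δ p q ≤ k

Allowed : Part → Set
Allowed (k ⟨ p ⟩) = (Primary p × 1 ≤ k) ⊎ (Secondary p × 2 ≤ k)

InE : List Part → Set
InE ν = All Allowed ν × Linked _≫_ ν

ForbiddenTriple : Part → Part → Part → Set
ForbiddenTriple x y z =
  (∃[ k ] (1 ≤ k × x ≡ (k + 2) ⟨ cd ⟩ × y ≡ (k + 2) ⟨ ab ⟩ × z ≡ k ⟨ c ⟩))
  ⊎ (∃[ k ] (1 ≤ k × x ≡ (k + 2) ⟨ cd ⟩ × y ≡ (k + 2) ⟨ ab ⟩ × z ≡ k ⟨ d ⟩))
  ⊎ (∃[ k ] (1 ≤ k × x ≡ (k + 2) ⟨ ad ⟩ × y ≡ (k + 1) ⟨ bc ⟩ × z ≡ k ⟨ a ⟩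
             × ¬ (x ≡ 3 ⟨ ad ⟩ × y ≡ 2 ⟨ bc ⟩ × z ≡ 1 ⟨ a ⟩)))

InE₁ : List Part → Set
InE₁ ν = InE ν × (∀ (pre : List Part) (x y z : Part) (post : List Part) →
                   ν ≡ pre ++ x ∷ y ∷ z ∷ post → ¬ ForbiddenTriple x y z)

SpecialPair : Part → Part → Set
SpecialPair x y = (∃[ k ] (x ≡ (k + 1) ⟨ ad ⟩ × y ≡ k ⟨ bc ⟩))
                ⊎ (∃[ k ] (x ≡ k ⟨ cd ⟩ × y ≡ k ⟨ ab ⟩))

Cond2 : List Part → Set
Cond2 ν = ∀ (pre : List Part) (x y z : Part) (post : List Part) →
          ν ≡ pre ++ x ∷ y ∷ z ∷ post →
          SpecialPair x y → ¬ (x ≡ 3 ⟨ ad ⟩ × y ≡ 2 ⟨ bc ⟩) →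
          x ⪰ (z +ₚ 2)

Claim1 : List Part → Set
Claim1 ν = ∀ (pre : List Part) (x y z : Part) (post : List Part) →
           ν ≡ pre ++ x ∷ y ∷ z ∷ post →
           Secondary (color y) → Primary (color z) →
           ¬ (color x ≡ ad × color y ≡ bc) → ¬ (color x ≡ cd × color y ≡ ab) →
           x ≻ (z +ₚ 2)

module Submission where

-- Lemma 2.3 is local: both claims only concern a window (x, y, z) of three
-- consecutive parts of ν ∈ ℰ, and all that is used about a window is
-- x ≫ y, y ≫ z and z ∈ 𝒫 ⊔ 𝒮.
--
-- Claim 1 is color bookkeeping.  Chaining the two ≫ steps gives
-- size x ≥ size z + Δ(q,r) + Δ(p,q) for the colors p, q, r of x, y, z.  When q is
-- secondary, r primary and (p,q) is not exceptional, Δ(q,r) = 1 + χ(q<r),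
-- Δ(p,q) ≥ 1 + χ(p<q), and χ(p≤r) ≤ χ(q<r) + χ(p<q) because q ≠ r; hence
-- Δ(q,r) + Δ(p,q) ≥ 2 + χ(p≤r), which is x ≻ z + 2.
--
-- For the equivalence, a special pair (x,y) forces size x ≥ size z + 2.  A strict
-- inequality gives x ≻ z + 2 whatever the colors; in the tight case, running
-- through the color r of z, the only failures of x ⪰ z + 2 are exactly the
-- forbidden triples of ℰ₁.  Conversely, a forbidden triple has size x = size z + 2
-- and c(x) < c(z), so it violates condition (2).

open import Defs
open import Data.Bool using (Bool; true; false; T; if_then_else_; _∨_)
open import Data.Bool.Properties using (∨-zeroʳ)
open import Data.Empty using (⊥-elim)
open import Data.List using (List; []; _∷_; _++_)
open import Data.List.Relation.Unary.All using (_∷_)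
open import Data.List.Relation.Unary.All.Properties using (++⁻ʳ)
open import Data.List.Relation.Unary.Linked using (Linked; _∷_; tail)
open import Data.Nat using (ℕ; suc; _+_; _≤_; _<_; s≤s; z≤n; _<ᵇ_; _≤ᵇ_)
open import Data.Nat.Properties
open import Data.Product using (_×_; _,_)
open import Data.Sum using (_⊎_; inj₁; inj₂; reduce)
open import Data.Unit using (tt)
open import Function using (_∘_)
open import Function.Bundles using (_⇔_; mk⇔)
open import Relation.Nullary using (¬_; yes; no)
open import Relation.Binary.PropositionalEquality

ind : Bool → ℕ
ind s = if s then 1 else 0

ind≤1 : ∀ s → ind s ≤ 1
ind≤1 true  = ≤-refl
ind≤1 false = z≤n

ind-mono : ∀ b₁ b₂ → (T b₁ → T b₂) → ind b₁ ≤ ind b₂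
ind-mono false _     _ = z≤n
ind-mono true  true  _ = ≤-refl
ind-mono true  false f = ⊥-elim (f tt)

ind-split : ∀ b₁ b₂ b₃ → (T b₁ → T b₂ ⊎ T b₃) → ind b₁ ≤ ind b₂ + ind b₃
ind-split false _     _     _ = z≤n
ind-split true  true  _     _ = s≤s z≤n
ind-split true  false true  _ = ≤-refl
ind-split true  false false f = ⊥-elim (reduce (f tt))

unrank : ℕ → Color
unrank 0 = ab
unrank 1 = ac
unrank 2 = ad
unrank 3 = a
unrank 4 = bc
unrank 5 = bd
unrank 6 = b
unrank 7 = cd
unrank 8 = c
unrank _ = d

unrank-rank : ∀ p → unrank (rank p) ≡ p
unrank-rank a  = refl
unrank-rank b  = refl
unrank-rank c  = refl
unrank-rank d  = refl
unrank-rank ab = refl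
unrank-rank ac = refl
unrank-rank ad = refl
unrank-rank bc = refl
unrank-rank bd = refl
unrank-rank cd = refl

rank-injective : ∀ {p q} → rank p ≡ rank q → p ≡ q
rank-injective {p} {q} eq =
  trans (sym (unrank-rank p)) (trans (cong unrank eq) (unrank-rank q))

secondary≢primary : ∀ {q r} → Secondary q → Primary r → q ≢ r
secondary≢primary sec pri refl with trans (sym pri) sec
... | ()

χ≤≤1 : ∀ p q → χ≤ p q ≤ 1
χ≤≤1 p q = ind≤1 (rank p ≤ᵇ rank q)

χ<≤χ≤ : ∀ p q → χ< p q ≤ χ≤ p q
χ<≤χ≤ p q = ind-mono (rank p <ᵇ rank q) (rank p ≤ᵇ rank q)
  (λ p<q → ≤⇒≤ᵇ (<⇒≤ (<ᵇ⇒< (rank p) (rank q) p<q)))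

-- If p ≤ r and q ≠ r, then q < r, or else r < q and so p < q.
χ≤-split : ∀ p q r → q ≢ r → χ≤ p r ≤ χ< q r + χ< p q
χ≤-split p q r q≢r =
  ind-split (rank p ≤ᵇ rank r) (rank q <ᵇ rank r) (rank p <ᵇ rank q) split
  where
  split : T (rank p ≤ᵇ rank r) → T (rank q <ᵇ rank r) ⊎ T (rank p <ᵇ rank q)
  split p≤r with rank q <? rank r
  ... | yes q<r = inj₁ (<⇒<ᵇ q<r)
  ... | no  q≮r = inj₂ (<⇒<ᵇ (≤-<-trans (≤ᵇ⇒≤ (rank p) (rank r) p≤r) r<q))
    where
    r<q : rank r < rank q
    r<q = ≤∧≢⇒< (≮⇒≥ q≮r) (q≢r ∘ rank-injective ∘ sym)

Δ-generic : ∀ p q → ¬ (p ≡ ad × q ≡ bc) → ¬ (p ≡ cd × q ≡ ab) →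
            Δ p q ≡ (if isPrimaryᵇ p ∨ isPrimaryᵇ q then 1 + χ< p q else 1 + χ≤ p q)
Δ-generic a  _  _ _ = refl
Δ-generic b  _  _ _ = refl
Δ-generic c  _  _ _ = refl
Δ-generic d  _  _ _ = refl
Δ-generic ab _  _ _ = refl
Δ-generic ac _  _ _ = refl
Δ-generic bc _  _ _ = refl
Δ-generic bd _  _ _ = refl
Δ-generic ad bc e _ = ⊥-elim (e (refl , refl))
Δ-generic ad a  _ _ = refl
Δ-generic ad b  _ _ = refl
Δ-generic ad c  _ _ = refl
Δ-generic ad d  _ _ = refl
Δ-generic ad ab _ _ = refl
Δ-generic ad ac _ _ = refl
Δ-generic ad ad _ _ = refl
Δ-generic ad bd _ _ = refl
Δ-generic ad cd _ _ = refl
Δ-generic cd ab _ e = ⊥-elim (e (refl , refl))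
Δ-generic cd a  _ _ = refl
Δ-generic cd b  _ _ = refl
Δ-generic cd c  _ _ = refl
Δ-generic cd d  _ _ = refl
Δ-generic cd ac _ _ = refl
Δ-generic cd ad _ _ = refl
Δ-generic cd bc _ _ = refl
Δ-generic cd bd _ _ = refl
Δ-generic cd cd _ _ = refl

Δ-primaryʳ : ∀ q r → Primary r → Δ q r ≡ 1 + χ< q r
Δ-primaryʳ q r pri
  rewrite Δ-generic q r (λ (_ , r≡bc) → secondary≢primary refl pri (sym r≡bc))
                        (λ (_ , r≡ab) → secondary≢primary refl pri (sym r≡ab))
        | pri | ∨-zeroʳ (isPrimaryᵇ q) = refl

Δ-lower : ∀ p q → ¬ (p ≡ ad × q ≡ bc) → ¬ (p ≡ cd × q ≡ ab) → 1 + χ< p q ≤ Δ p q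
Δ-lower p q e₁ e₂ rewrite Δ-generic p q e₁ e₂ with isPrimaryᵇ p ∨ isPrimaryᵇ q
... | true  = ≤-refl
... | false = s≤s (χ<≤χ≤ p q)

two-step-colors : ∀ p q r → Secondary q → Primary r →
                  ¬ (p ≡ ad × q ≡ bc) → ¬ (p ≡ cd × q ≡ ab) →
                  2 + χ≤ p r ≤ Δ q r + Δ p q
two-step-colors p q r sec pri e₁ e₂ = begin
  2 + χ≤ p r                   ≤⟨ +-monoʳ-≤ 2 (χ≤-split p q r (secondary≢primary sec pri)) ⟩
  2 + (χ< q r + χ< p q)        ≡⟨ cong suc (sym (+-suc (χ< q r) (χ< p q))) ⟩
  (1 + χ< q r) + (1 + χ< p q)  ≤⟨ +-monoʳ-≤ (1 + χ< q r) (Δ-lower p q e₁ e₂) ⟩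
  (1 + χ< q r) + Δ p q         ≡⟨ cong (_+ Δ p q) (sym (Δ-primaryʳ q r pri)) ⟩
  Δ q r + Δ p q                ∎
  where open ≤-Reasoning

linked-++⁻ʳ : ∀ {R : Part → Part → Set} xs {ys} → Linked R (xs ++ ys) → Linked R ys
linked-++⁻ʳ []       l = l
linked-++⁻ʳ (_ ∷ xs) l = linked-++⁻ʳ xs (tail l)

record Window (x y z : Part) : Set where
  field
    x≫y       : x ≫ y
    y≫z       : y ≫ z
    z-allowed : Allowed z

window : ∀ {ν} pre {x y z post} → InE ν → ν ≡ pre ++ x ∷ y ∷ z ∷ post → Window x y z
window pre (allowed , linked) refl with ++⁻ʳ pre allowed | linked-++⁻ʳ pre linked
... | _ ∷ _ ∷ z-allowed ∷ _ | x≫y ∷ y≫z ∷ _ =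
  record { x≫y = x≫y ; y≫z = y≫z ; z-allowed = z-allowed }

claim1 : (ν : List Part) → InE ν → Claim1 ν
claim1 ν e pre (k ⟨ p ⟩) (m ⟨ q ⟩) (l ⟨ r ⟩) post eq sec pri e₁ e₂ = begin
  l + 2 + χ≤ p r       ≡⟨ +-assoc l 2 (χ≤ p r) ⟩
  l + (2 + χ≤ p r)     ≤⟨ +-monoʳ-≤ l (two-step-colors p q r sec pri e₁ e₂) ⟩
  l + (Δ q r + Δ p q)  ≡⟨ sym (+-assoc l (Δ q r) (Δ p q)) ⟩
  l + Δ q r + Δ p q    ≤⟨ +-monoˡ-≤ (Δ p q) y≫z ⟩
  m + Δ p q            ≤⟨ x≫y ⟩
  k                    ∎
  where
  open Window (window pre e eq)
  open ≤-Reasoning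

≻-by-gap : ∀ {k l} p r → l < k → (k ⟨ p ⟩) ≻ (l ⟨ r ⟩)
≻-by-gap {k} {l} p r l<k =
  ≤-trans (+-monoʳ-≤ l (χ≤≤1 p r)) (subst (_≤ k) (+-comm 1 l) l<k)

≻-same-size : ∀ {n} p r → χ≤ p r ≡ 0 → (n ⟨ p ⟩) ≻ (n ⟨ r ⟩)
≻-same-size {n} _ _ r<p rewrite r<p = ≤-reflexive (+-identityʳ n)

⋡-same-size : ∀ {n p r} → χ≤ p r ≡ 1 → p ≢ r → ¬ ((n ⟨ p ⟩) ⪰ (n ⟨ r ⟩))
⋡-same-size {n} p≤r _   (inj₁ p≻r) = m+1+n≰m n (subst (λ χ → n + χ ≤ n) p≤r p≻r)
⋡-same-size     _   p≢r (inj₂ eq)  = p≢r (cong color eq)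

primary-positive : ∀ {k} p → Allowed (k ⟨ p ⟩) → Primary p → 1 ≤ k
primary-positive _ (inj₁ (_ , 1≤k)) _   = 1≤k
primary-positive _ (inj₂ (sec , _)) pri = ⊥-elim (secondary≢primary sec pri refl)

-- Condition (2) for special pairs (k_cd, k_ab).  As ab is the least color, Δ(ab, r) = 2 for every r.
Δ-ab : ∀ r → Δ ab r ≡ 2
Δ-ab a  = refl
Δ-ab b  = refl
Δ-ab c  = refl
Δ-ab d  = refl
Δ-ab ab = refl
Δ-ab ac = refl
Δ-ab ad = refl
Δ-ab bc = refl
Δ-ab bd = refl
Δ-ab cd = refl

-- The tight case k = l + 2: only r ∈ {c, d} lies above cd, giving forbidden triples.
cd-tight : ∀ {l} r → Allowed (l ⟨ r ⟩) →
           ¬ ForbiddenTriple ((l + 2) ⟨ cd ⟩) ((l + 2) ⟨ ab ⟩) (l ⟨ r ⟩) →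
           ((l + 2) ⟨ cd ⟩) ⪰ ((l + 2) ⟨ r ⟩)
cd-tight cd _ _ = inj₂ refl
cd-tight c  allowed forbidden =
  ⊥-elim (forbidden (inj₁ (_ , primary-positive c allowed refl , refl , refl , refl)))
cd-tight d  allowed forbidden =
  ⊥-elim (forbidden (inj₂ (inj₁ (_ , primary-positive d allowed refl , refl , refl , refl))))
cd-tight a  _ _ = inj₁ (≻-same-size cd a refl)
cd-tight b  _ _ = inj₁ (≻-same-size cd b refl)
cd-tight ab _ _ = inj₁ (≻-same-size cd ab refl)
cd-tight ac _ _ = inj₁ (≻-same-size cd ac refl)
cd-tight ad _ _ = inj₁ (≻-same-size cd ad refl)
cd-tight bc _ _ = inj₁ (≻-same-size cd bc refl)
cd-tight bd _ _ = inj₁ (≻-same-size cd bd refl)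

-- Either k > size z + 2 and x ≻ z + 2 by the size gap, or we are in the tight case.
cd-special : ∀ {k l r} → Window (k ⟨ cd ⟩) (k ⟨ ab ⟩) (l ⟨ r ⟩) →
             ¬ ForbiddenTriple (k ⟨ cd ⟩) (k ⟨ ab ⟩) (l ⟨ r ⟩) →
             (k ⟨ cd ⟩) ⪰ ((l ⟨ r ⟩) +ₚ 2)
cd-special {l = l} {r} w forbidden with m≤n⇒m<n∨m≡n l+2≤k
  where
  l+2≤k : l + 2 ≤ _
  l+2≤k = subst (λ δ → l + δ ≤ _) (Δ-ab r) (Window.y≫z w)
... | inj₁ l+2<k = inj₁ (≻-by-gap cd r l+2<k)
... | inj₂ refl  = cd-tight r (Window.z-allowed w) forbidden

-- Condition (2) for special pairs ((k+1)_ad, k_bc).  Here only Δ(bc, r) ≥ 1 is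
-- available in general, which still gives k + 1 ≥ size z + 2.
Δ-bc-positive : ∀ r → 1 ≤ Δ bc r
Δ-bc-positive r with isPrimaryᵇ r
... | true  = s≤s z≤n
... | false = s≤s z≤n

-- Rules out Δ(bc, r) = 2 in the tight case, where y = (l+1)_bc and z = l_r.
n+2≰n+1 : ∀ {n} → ¬ (n + 2 ≤ n + 1)
n+2≰n+1 {n} n+2≤n+1 with +-cancelˡ-≤ n 2 1 n+2≤n+1
... | s≤s ()

-- The tight case: colors above ad either are a, giving a forbidden triple,
-- or have Δ(bc, r) = 2, contradicting y ≫ z.
ad-tight : ∀ {x y l} r → x ≡ (l + 2) ⟨ ad ⟩ → y ≡ (l + 1) ⟨ bc ⟩ →
           Window x y (l ⟨ r ⟩) → ¬ ForbiddenTriple x y (l ⟨ r ⟩) →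
           ¬ (x ≡ 3 ⟨ ad ⟩ × y ≡ 2 ⟨ bc ⟩) → x ⪰ ((l + 2) ⟨ r ⟩)
ad-tight ad refl refl _ _ _ = inj₂ refl
ad-tight a  refl refl w forbidden not-exception =
  ⊥-elim (forbidden (inj₂ (inj₂ (_ , primary-positive a (Window.z-allowed w) refl ,
                                 refl , refl , refl ,
                                 λ (x≡ , y≡ , _) → not-exception (x≡ , y≡)))))
ad-tight ab refl refl _ _ _ = inj₁ (≻-same-size ad ab refl)
ad-tight ac refl refl _ _ _ = inj₁ (≻-same-size ad ac refl)
ad-tight b  refl refl w _ _ = ⊥-elim (n+2≰n+1 (Window.y≫z w))
ad-tight c  refl refl w _ _ = ⊥-elim (n+2≰n+1 (Window.y≫z w))
ad-tight d  refl refl w _ _ = ⊥-elim (n+2≰n+1 (Window.y≫z w))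
ad-tight bc refl refl w _ _ = ⊥-elim (n+2≰n+1 (Window.y≫z w))
ad-tight bd refl refl w _ _ = ⊥-elim (n+2≰n+1 (Window.y≫z w))
ad-tight cd refl refl w _ _ = ⊥-elim (n+2≰n+1 (Window.y≫z w))

-- As for cd-special; in the tight case k = l + 1 and x = (l+2)_ad.
ad-special : ∀ {k l r} → Window ((k + 1) ⟨ ad ⟩) (k ⟨ bc ⟩) (l ⟨ r ⟩) →
             ¬ ForbiddenTriple ((k + 1) ⟨ ad ⟩) (k ⟨ bc ⟩) (l ⟨ r ⟩) →
             ¬ ((k + 1) ⟨ ad ⟩ ≡ 3 ⟨ ad ⟩ × k ⟨ bc ⟩ ≡ 2 ⟨ bc ⟩) →
             ((k + 1) ⟨ ad ⟩) ⪰ ((l ⟨ r ⟩) +ₚ 2)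
ad-special {k} {l} {r} w forbidden not-exception with m≤n⇒m<n∨m≡n l+2≤k+1
  where
  l+1≤k : l + 1 ≤ k
  l+1≤k = ≤-trans (+-monoʳ-≤ l (Δ-bc-positive r)) (Window.y≫z w)
  l+2≤k+1 : l + 2 ≤ k + 1
  l+2≤k+1 = subst (_≤ k + 1) (+-assoc l 1 1) (+-monoˡ-≤ 1 l+1≤k)
... | inj₁ l+2<k+1 = inj₁ (≻-by-gap ad r l+2<k+1)
... | inj₂ l+2≡k+1 =
  ad-tight r (cong (_⟨ ad ⟩) (sym l+2≡k+1)) (cong (_⟨ bc ⟩) k≡l+1) w forbidden not-exception
  where
  k≡l+1 : k ≡ l + 1
  k≡l+1 = +-cancelʳ-≡ 1 k (l + 1) (trans (sym l+2≡k+1) (sym (+-assoc l 1 1)))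

E₁⇒cond2 : (ν : List Part) → InE₁ ν → Cond2 ν
E₁⇒cond2 ν (e , no-forbidden) pre _ _ (_ ⟨ _ ⟩) post eq (inj₁ (_ , refl , refl)) not-exc =
  ad-special (window pre e eq) (no-forbidden pre _ _ _ post eq) not-exc
E₁⇒cond2 ν (e , no-forbidden) pre _ _ (_ ⟨ _ ⟩) post eq (inj₂ (_ , refl , refl)) _ =
  cd-special (window pre e eq) (no-forbidden pre _ _ _ post eq)

-- A forbidden triple is a special pair followed by a part z with
-- size z + 2 = size x and c(x) < c(z), so it violates condition (2).
cond2⇒E₁ : (ν : List Part) → InE ν → Cond2 ν → InE₁ ν
cond2⇒E₁ ν e cond2 = e , no-forbidden
  where
  no-forbidden : ∀ pre x y z post → ν ≡ pre ++ x ∷ y ∷ z ∷ post → ¬ ForbiddenTriple x y z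
  no-forbidden pre _ _ _ post eq (inj₁ (k , _ , refl , refl , refl)) =
    ⋡-same-size refl (λ ())
      (cond2 pre _ _ _ post eq (inj₂ (k + 2 , refl , refl)) (λ { (() , _) }))
  no-forbidden pre _ _ _ post eq (inj₂ (inj₁ (k , _ , refl , refl , refl))) =
    ⋡-same-size refl (λ ())
      (cond2 pre _ _ _ post eq (inj₂ (k + 2 , refl , refl)) (λ { (() , _) }))
  no-forbidden pre _ _ _ post eq (inj₂ (inj₂ (k , _ , refl , refl , refl , not-exc))) =
    ⋡-same-size refl (λ ())
      (cond2 pre _ _ _ post eq (inj₁ (k + 1 , cong (_⟨ ad ⟩) (sym (+-assoc k 1 1)) , refl))
             (λ (x≡ , y≡) → not-exc (x≡ , y≡ , z≡ y≡)))
    where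
    z≡ : (k + 1) ⟨ bc ⟩ ≡ 2 ⟨ bc ⟩ → k ⟨ a ⟩ ≡ 1 ⟨ a ⟩
    z≡ y≡ = cong (_⟨ a ⟩) (+-cancelʳ-≡ 1 k 1 (cong size y≡))

lemma2p3 : (ν : List Part) → InE ν → Claim1 ν × (InE₁ ν ⇔ Cond2 ν)
lemma2p3 ν e = claim1 ν e , mk⇔ (E₁⇒cond2 ν) (cond2⇒E₁ ν e)
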